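{- Let $f$ be a $\{0,1\}$-valued binary function. If $f$ is not linear, then $f$ has a proper minor that is not linear.
   Context: A binary function on a finite ground set $E$ is a function $f\colon 2^E\to\mathbb{R}$ with $f(\emptyset)=1$; its order is $|E|$. A binary function $f$ is linear if it is $\{0,1\}$-valued and for all $X,Y\subseteq E$, $f(X)=f(Y)=1$ implies $f(X\triangle Y)=1$ (i.e. $f$ is the indicator function of a binary vector space, identifying subsets with their characteristic vectors). For $X\subseteq E$, the contraction $f/X\colon 2^{E\setminus X}\to\mathbb{R}$ is $f/X(Y)=f(Y)$, and the deletion $f\setminus X\colon 2^{E\setminus X}\to\mathbb{R}$ is $f\setminus X(Y)=\frac{\sum_{Z\subseteq X} f(Y\cup Z)}{\sum_{Z\subseteq X} f(Z)}$, well defined exactly when the denominator is nonzero. A minor of $f$ is a well-defined binary function $(f/X)\setminus Y$ for disjoint $X,Y\subseteq E$; it is proper if its order is less than $|E|$. -}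

module Defs where

open import Data.Bool using (Bool; true; false; _xor_)
open import Data.Nat using (ℕ; zero; suc)
open import Data.Vec using (Vec; []; _∷_; zipWith)
open import Data.List using (List; []; _∷_; [_]; map; _++_; foldr)
open import Data.Product using (_×_)
open import Data.Sum using (_⊎_)
open import Data.Fin.Subset using (Subset; _⊆_; _∪_; _∩_; ⊥; ⊤)
open import Data.Rational using (ℚ; 0ℚ; 1ℚ; _+_; _÷_; NonZero)
open import Relation.Binary.PropositionalEquality using (_≡_)

-- A function on 2^E, E = Fin n, with rational values.
-- (Minors of {0,1}-valued functions are rational-valued.)
SetFn : ℕ → Set
SetFn n = Subset n → ℚ

IsBinaryFn : ∀ {n} → SetFn n → Set
IsBinaryFn f = f ⊥ ≡ 1ℚ

_△_ : ∀ {n} → Subset n → Subset n → Subset n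
_△_ = zipWith _xor_

Disjoint : ∀ {n} → Subset n → Subset n → Set
Disjoint X Y = X ∩ Y ≡ ⊥

ZeroOneOn : ∀ {n} → Subset n → SetFn n → Set
ZeroOneOn S f = ∀ A → A ⊆ S → (f A ≡ 0ℚ ⊎ f A ≡ 1ℚ)

LinearOn : ∀ {n} → Subset n → SetFn n → Set
LinearOn S f = ZeroOneOn S f ×
  (∀ A B → A ⊆ S → B ⊆ S → f A ≡ 1ℚ → f B ≡ 1ℚ → f (A △ B) ≡ 1ℚ)

Linear : ∀ {n} → SetFn n → Set
Linear f = LinearOn ⊤ f

subsetsOf : ∀ {n} → Subset n → List (Subset n)
subsetsOf [] = [ [] ]
subsetsOf (false ∷ Y) = map (false ∷_) (subsetsOf Y)
subsetsOf (true ∷ Y) = map (false ∷_) (subsetsOf Y) ++ map (true ∷_) (subsetsOf Y)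

sumSub : ∀ {n} → Subset n → (Subset n → ℚ) → ℚ
sumSub Y h = foldr (λ Z acc → h Z + acc) 0ℚ (subsetsOf Y)

delDen : ∀ {n} → SetFn n → Subset n → ℚ
delDen f Y = sumSub Y f

-- the minor (f/X)\Y, as a function on subsets W of E∖(X∪Y)
-- (values outside that ground set are irrelevant);
-- f/X(Z) = f(Z), and (f/X)\Y(W) = Σ_{Z⊆Y} f(W∪Z) / Σ_{Z⊆Y} f(Z).
minor : ∀ {n} (f : SetFn n) (X Y : Subset n) → .{{NonZero (delDen f Y)}} → SetFn n
minor f X Y W = sumSub Y (λ Z → f (W ∪ Z)) ÷ delDen f Y

-- A violation of linearity is a triple A, B, A △ B with values 1, 1, 0.  Pick d ∈ A ∖ B and
-- put A' = A ∖ d, C = (A △ B) ∖ d.  Both minors on E ∖ d are determined by f: the contraction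
-- is f itself, and the deletion satisfies M W · (1 + f{d}) = f W + f (W ∪ d).  As
-- f (A' ∪ d) = f A = 1, f B = 1 and f (C ∪ d) = f (A △ B) = 0, a linear deletion forces
-- f C = 1; a linear contraction then forces f A' = f (B △ C) = 1; and f (A' ∪ d) = f A' = 1
-- together with f C ≠ f (C ∪ d) is incompatible with M being {0,1}-valued, whatever f{d} is.
module Submission where

open import Defs
open import Data.Nat using (ℕ; _<_)
import Data.Nat as ℕ
open import Data.Nat.Properties using (n<1+n)
open import Data.Bool using (true; false; _xor_)
open import Data.Bool.Properties using (xor-assoc; xor-comm; xor-identityʳ; ∨-identityʳ)
open import Data.Fin using (Fin; zero; suc)
open import Data.Fin.Subset using (Subset; ∣_∣; ∁; _∪_; ⊤; ⊥; ⁅_⁆; _⊆_; _∈_)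
open import Data.Fin.Subset.Properties
  using (⊆⊤; ∪-identityˡ; ∪-identityʳ; ∩-zeroˡ; ∩-zeroʳ; x∈⁅x⁆; x∈⁅y⁆⇒x≡y; x∉p⇒x∈∁p;
         ∣∁p∣≡n∸∣p∣; ∣⁅x⁆∣≡1; nonempty?; Empty-unique; anySubset?)
open import Data.Vec using ([]; _∷_; lookup)
open import Data.Vec.Properties using (zipWith-assoc; zipWith-comm; zipWith-identityʳ; lookup-zipWith; []=⇒lookup)
import Data.List as List
open import Data.Rational using (ℚ; 0ℚ; 1ℚ; _+_; _*_; _÷_; 1/_; NonZero)
open import Data.Rational.Properties using (_≟_; +-comm; +-identityʳ; *-assoc; *-inverseˡ; *-identityʳ)
open import Data.Product using (Σ; ∃-syntax; _×_; _,_; proj₁)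
open import Data.Sum using (_⊎_; inj₁; inj₂)
open import Data.Empty using (⊥-elim)
open import Relation.Nullary using (¬_; yes; no; ¬?; _×-dec_)
open import Relation.Nullary.Decidable using (decidable-stable)
open import Relation.Binary.PropositionalEquality using (_≡_; _≢_; refl; sym; trans; cong; cong₂; subst; module ≡-Reasoning)

ZeroOne : ℚ → Set
ZeroOne x = x ≡ 0ℚ ⊎ x ≡ 1ℚ

HasNonlinearProperMinor : ∀ {n} → SetFn n → Set
HasNonlinearProperMinor {n} f = ∃[ X ] ∃[ Y ] (Disjoint X Y × ∣ ∁ (X ∪ Y) ∣ < n ×
  Σ (NonZero (delDen f Y)) (λ nz → ¬ LinearOn (∁ (X ∪ Y)) (minor f X Y {{nz}})))

module _ {n : ℕ} where

  △-assoc : (X Y Z : Subset n) → (X △ Y) △ Z ≡ X △ (Y △ Z)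
  △-assoc = zipWith-assoc xor-assoc

  △-comm : (X Y : Subset n) → X △ Y ≡ Y △ X
  △-comm = zipWith-comm xor-comm

  △-identityʳ : (X : Subset n) → X △ ⊥ ≡ X
  △-identityʳ = zipWith-identityʳ xor-identityʳ

△-self : ∀ {n} (X : Subset n) → X △ X ≡ ⊥
△-self [] = refl
△-self (true ∷ X) = cong (false ∷_) (△-self X)
△-self (false ∷ X) = cong (false ∷_) (△-self X)

△-cancelʳ : ∀ {n} (X Y : Subset n) → (X △ Y) △ Y ≡ X
△-cancelʳ X Y = begin
  (X △ Y) △ Y   ≡⟨ △-assoc X Y Y ⟩
  X △ (Y △ Y)   ≡⟨ cong (X △_) (△-self Y) ⟩
  X △ ⊥         ≡⟨ △-identityʳ X ⟩
  X             ∎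
  where open ≡-Reasoning

lookup-⁅x⁆ : ∀ {n} (x : Fin n) → lookup ⁅ x ⁆ x ≡ true
lookup-⁅x⁆ x = []=⇒lookup (x∈⁅x⁆ x)

∪⁅x⁆≡△⁅x⁆ : ∀ {n} (x : Fin n) (W : Subset n) → lookup W x ≡ false → W ∪ ⁅ x ⁆ ≡ W △ ⁅ x ⁆
∪⁅x⁆≡△⁅x⁆ zero (false ∷ W) _ = cong (true ∷_) (trans (∪-identityʳ W) (sym (△-identityʳ W)))
∪⁅x⁆≡△⁅x⁆ (suc x) (b ∷ W) x∉W =
  cong₂ _∷_ (trans (∨-identityʳ b) (sym (xor-identityʳ b))) (∪⁅x⁆≡△⁅x⁆ x W x∉W)

⊆∁⁅x⁆ : ∀ {n} (x : Fin n) (W : Subset n) → lookup W x ≡ false → W ⊆ ∁ ⁅ x ⁆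
⊆∁⁅x⁆ x W x∉W {y} y∈W = x∉p⇒x∈∁p y∉⁅x⁆
  where
  y∉⁅x⁆ : ¬ (y ∈ ⁅ x ⁆)
  y∉⁅x⁆ y∈⁅x⁆ with x∈⁅y⁆⇒x≡y x y∈⁅x⁆
  ... | refl with trans (sym ([]=⇒lookup y∈W)) x∉W
  ...   | ()

∣∁⁅x⁆∣<n : ∀ {n} (x : Fin n) → ∣ ∁ ⁅ x ⁆ ∣ < n
∣∁⁅x⁆∣<n {ℕ.suc n} x rewrite ∣∁p∣≡n∸∣p∣ ⁅ x ⁆ | ∣⁅x⁆∣≡1 x = n<1+n n

p÷q*q≡p : ∀ p q .{{_ : NonZero q}} → p ÷ q * q ≡ p
p÷q*q≡p p q = begin
  p * (1/ q) * q    ≡⟨ *-assoc p (1/ q) q ⟩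
  p * (1/ q * q)    ≡⟨ cong (p *_) (*-inverseˡ q) ⟩
  p * 1ℚ            ≡⟨ *-identityʳ p ⟩
  p                 ∎
  where open ≡-Reasoning

0≢1 : 0ℚ ≢ 1ℚ
0≢1 ()

ZeroOne∧≢1⇒≡0 : ∀ {x} → ZeroOne x → x ≢ 1ℚ → x ≡ 0ℚ
ZeroOne∧≢1⇒≡0 (inj₁ x≡0) _ = x≡0
ZeroOne∧≢1⇒≡0 (inj₂ x≡1) x≢1 = ⊥-elim (x≢1 x≡1)

1+ZeroOne-nonZero : ∀ {x} → ZeroOne x → NonZero (1ℚ + x)
1+ZeroOne-nonZero (inj₁ refl) = _
1+ZeroOne-nonZero (inj₂ refl) = _

m*[1+δ]≡1+b⇒m≡1 : ∀ {m δ b} → ZeroOne m → ZeroOne δ → ZeroOne b → m * (1ℚ + δ) ≡ 1ℚ + b → m ≡ 1ℚ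
m*[1+δ]≡1+b⇒m≡1 (inj₂ refl) _ _ _ = refl
m*[1+δ]≡1+b⇒m≡1 (inj₁ refl) (inj₁ refl) (inj₁ refl) ()
m*[1+δ]≡1+b⇒m≡1 (inj₁ refl) (inj₁ refl) (inj₂ refl) ()
m*[1+δ]≡1+b⇒m≡1 (inj₁ refl) (inj₂ refl) (inj₁ refl) ()
m*[1+δ]≡1+b⇒m≡1 (inj₁ refl) (inj₂ refl) (inj₂ refl) ()

m*[1+δ]≡0+0⇒m≢1 : ∀ {m δ} → ZeroOne δ → m * (1ℚ + δ) ≡ 0ℚ + 0ℚ → m ≢ 1ℚ
m*[1+δ]≡0+0⇒m≢1 (inj₁ refl) () refl
m*[1+δ]≡0+0⇒m≢1 (inj₂ refl) () refl

m*[1+0]≢1+1 : ∀ {m} → ZeroOne m → m * (1ℚ + 0ℚ) ≢ 1ℚ + 1ℚ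
m*[1+0]≢1+1 (inj₁ refl) ()
m*[1+0]≢1+1 (inj₂ refl) ()

m*[1+1]≢1+0 : ∀ {m} → ZeroOne m → m * (1ℚ + 1ℚ) ≢ 1ℚ + 0ℚ
m*[1+1]≢1+0 (inj₁ refl) ()
m*[1+1]≢1+0 (inj₂ refl) ()

subsetsOf-⊥ : ∀ n → subsetsOf (⊥ {n}) ≡ List.[ ⊥ ]
subsetsOf-⊥ ℕ.zero = refl
subsetsOf-⊥ (ℕ.suc n) rewrite subsetsOf-⊥ n = refl

subsetsOf-⁅x⁆ : ∀ {n} (x : Fin n) → subsetsOf ⁅ x ⁆ ≡ ⊥ List.∷ List.[ ⁅ x ⁆ ]
subsetsOf-⁅x⁆ {ℕ.suc n} zero rewrite subsetsOf-⊥ n = refl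
subsetsOf-⁅x⁆ (suc x) rewrite subsetsOf-⁅x⁆ x = refl

sumSub-⊥ : ∀ {n} (h : Subset n → ℚ) → sumSub ⊥ h ≡ h ⊥
sumSub-⊥ {n} h rewrite subsetsOf-⊥ n = +-identityʳ (h ⊥)

sumSub-⁅x⁆ : ∀ {n} (x : Fin n) (h : Subset n → ℚ) → sumSub ⁅ x ⁆ h ≡ h ⊥ + h ⁅ x ⁆
sumSub-⁅x⁆ x h rewrite subsetsOf-⁅x⁆ x = cong (h ⊥ +_) (+-identityʳ (h ⁅ x ⁆))

module _ {n : ℕ} (f : SetFn n) (binary : IsBinaryFn f) where

  delDen-⊥ : delDen f ⊥ ≡ 1ℚ
  delDen-⊥ = trans (sumSub-⊥ f) binary

  delDen-⁅x⁆ : ∀ x → delDen f ⁅ x ⁆ ≡ 1ℚ + f ⁅ x ⁆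
  delDen-⁅x⁆ x = trans (sumSub-⁅x⁆ x f) (cong (_+ f ⁅ x ⁆) binary)

  minor-⊥ : ∀ X .{{_ : NonZero (delDen f ⊥)}} W → minor f X ⊥ W ≡ f W
  minor-⊥ X W = begin
    minor f X ⊥ W                  ≡⟨ sym (*-identityʳ _) ⟩
    minor f X ⊥ W * 1ℚ             ≡⟨ cong (minor f X ⊥ W *_) (sym delDen-⊥) ⟩
    minor f X ⊥ W * delDen f ⊥     ≡⟨ p÷q*q≡p _ (delDen f ⊥) ⟩
    sumSub ⊥ (λ Z → f (W ∪ Z))     ≡⟨ sumSub-⊥ (λ Z → f (W ∪ Z)) ⟩
    f (W ∪ ⊥)                      ≡⟨ cong f (∪-identityʳ W) ⟩
    f W                            ∎
    where open ≡-Reasoning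

  minor-⁅x⁆ : ∀ X x .{{_ : NonZero (delDen f ⁅ x ⁆)}} W →
              minor f X ⁅ x ⁆ W * (1ℚ + f ⁅ x ⁆) ≡ f W + f (W ∪ ⁅ x ⁆)
  minor-⁅x⁆ X x W = begin
    minor f X ⁅ x ⁆ W * (1ℚ + f ⁅ x ⁆)     ≡⟨ cong (minor f X ⁅ x ⁆ W *_) (sym (delDen-⁅x⁆ x)) ⟩
    minor f X ⁅ x ⁆ W * delDen f ⁅ x ⁆     ≡⟨ p÷q*q≡p _ (delDen f ⁅ x ⁆) ⟩
    sumSub ⁅ x ⁆ (λ Z → f (W ∪ Z))         ≡⟨ sumSub-⁅x⁆ x (λ Z → f (W ∪ Z)) ⟩
    f (W ∪ ⊥) + f (W ∪ ⁅ x ⁆)              ≡⟨ cong (λ V → f V + f (W ∪ ⁅ x ⁆)) (∪-identityʳ W) ⟩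
    f W + f (W ∪ ⁅ x ⁆)                    ∎
    where open ≡-Reasoning

module PointMinors {n : ℕ} (f : SetFn n) (binary : IsBinaryFn f) (zeroOne : ZeroOneOn ⊤ f) (d : Fin n) where

  D : Subset n
  D = ∁ ⁅ d ⁆

  zeroOne-at : ∀ W → ZeroOne (f W)
  zeroOne-at W = zeroOne W ⊆⊤

  instance
    nonZero-⊥ : NonZero (delDen f ⊥)
    nonZero-⊥ = subst NonZero (sym (delDen-⊥ f binary)) _

    nonZero-⁅d⁆ : NonZero (delDen f ⁅ d ⁆)
    nonZero-⁅d⁆ = subst NonZero (sym (delDen-⁅x⁆ f binary d)) (1+ZeroOne-nonZero (zeroOne-at ⁅ d ⁆))

  contraction deletion : SetFn n
  contraction = minor f ⁅ d ⁆ ⊥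
  deletion = minor f ⊥ ⁅ d ⁆

  lift : Subset n → ℚ
  lift W = f (W ∪ ⁅ d ⁆)

  via-minor : ∀ X Y {{_ : NonZero (delDen f Y)}} → Disjoint X Y → X ∪ Y ≡ ⁅ d ⁆ →
              ¬ LinearOn D (minor f X Y) → HasNonlinearProperMinor f
  via-minor X Y {{nz}} disjoint X∪Y≡⁅d⁆ nonlinear =
    X , Y , disjoint , subst (λ S → ∣ ∁ S ∣ < n) (sym X∪Y≡⁅d⁆) (∣∁⁅x⁆∣<n d) , nz ,
    subst (λ S → ¬ LinearOn (∁ S) (minor f X Y)) (sym X∪Y≡⁅d⁆) nonlinear

  via-contraction : ¬ LinearOn D contraction → HasNonlinearProperMinor f
  via-contraction = via-minor ⁅ d ⁆ ⊥ (∩-zeroʳ ⁅ d ⁆) (∪-identityʳ ⁅ d ⁆)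

  via-deletion : ¬ LinearOn D deletion → HasNonlinearProperMinor f
  via-deletion = via-minor ⊥ ⁅ d ⁆ (∩-zeroˡ ⁅ d ⁆) (∪-identityˡ ⁅ d ⁆)

  contraction-nonlinear : ∀ {W V} → W ⊆ D → V ⊆ D →
    f W ≡ 1ℚ → f V ≡ 1ℚ → f (W △ V) ≡ 0ℚ → ¬ LinearOn D contraction
  contraction-nonlinear {W} {V} W⊆D V⊆D fW≡1 fV≡1 fW△V≡0 (_ , closed) =
    0≢1 (trans (sym fW△V≡0) (trans (sym (minor-⊥ f binary ⁅ d ⁆ (W △ V)))
      (closed W V W⊆D V⊆D (trans (minor-⊥ f binary ⁅ d ⁆ W) fW≡1) (trans (minor-⊥ f binary ⁅ d ⁆ V) fV≡1))))

  deletion-weight : ∀ {W δ a b} → f ⁅ d ⁆ ≡ δ → f W ≡ a → lift W ≡ b → deletion W * (1ℚ + δ) ≡ a + b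
  deletion-weight {W} refl refl refl = minor-⁅x⁆ f binary ⊥ d W

  deletion≡1 : ∀ {W} → ZeroOne (deletion W) → f W ≡ 1ℚ ⊎ lift W ≡ 1ℚ → deletion W ≡ 1ℚ
  deletion≡1 {W} zo (inj₁ fW≡1) =
    m*[1+δ]≡1+b⇒m≡1 zo (zeroOne-at ⁅ d ⁆) (zeroOne-at (W ∪ ⁅ d ⁆)) (deletion-weight refl fW≡1 refl)
  deletion≡1 {W} zo (inj₂ liftW≡1) =
    m*[1+δ]≡1+b⇒m≡1 zo (zeroOne-at ⁅ d ⁆) (zeroOne-at W)
      (trans (deletion-weight refl refl liftW≡1) (+-comm (f W) 1ℚ))

  deletion-nonlinear : ∀ {W V} → W ⊆ D → V ⊆ D → lift W ≡ 1ℚ → f V ≡ 1ℚ →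
    f (W △ V) ≡ 0ℚ → lift (W △ V) ≡ 0ℚ → ¬ LinearOn D deletion
  deletion-nonlinear {W} {V} W⊆D V⊆D liftW≡1 fV≡1 fW△V≡0 liftW△V≡0 (zo , closed) =
    m*[1+δ]≡0+0⇒m≢1 (zeroOne-at ⁅ d ⁆) (deletion-weight refl fW△V≡0 liftW△V≡0)
      (closed W V W⊆D V⊆D (deletion≡1 (zo W W⊆D) (inj₂ liftW≡1)) (deletion≡1 (zo V V⊆D) (inj₁ fV≡1)))

  -- The first point rules out f{d} = 0, the second f{d} = 1.
  deletion-not-zeroOne : ∀ {W V} → W ⊆ D → V ⊆ D → f W ≡ 1ℚ → lift W ≡ 1ℚ →
    f V ≡ 1ℚ → lift V ≡ 0ℚ → ¬ ZeroOneOn D deletion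
  deletion-not-zeroOne {W} {V} W⊆D V⊆D fW≡1 liftW≡1 fV≡1 liftV≡0 zo with zeroOne-at ⁅ d ⁆
  ... | inj₁ f⁅d⁆≡0 = m*[1+0]≢1+1 (zo W W⊆D) (deletion-weight f⁅d⁆≡0 fW≡1 liftW≡1)
  ... | inj₂ f⁅d⁆≡1 = m*[1+1]≢1+0 (zo V V⊆D) (deletion-weight f⁅d⁆≡1 fV≡1 liftV≡0)

  module Separated {A B : Subset n} (d∈A : lookup A d ≡ true) (d∉B : lookup B d ≡ false)
    (fA≡1 : f A ≡ 1ℚ) (fB≡1 : f B ≡ 1ℚ) (fA△B≡0 : f (A △ B) ≡ 0ℚ) where

    A' C : Subset n
    A' = A △ ⁅ d ⁆
    C = A' △ B

    d∉A' : lookup A' d ≡ false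
    d∉A' = trans (lookup-zipWith _xor_ d A ⁅ d ⁆) (cong₂ _xor_ d∈A (lookup-⁅x⁆ d))

    d∉C : lookup C d ≡ false
    d∉C = trans (lookup-zipWith _xor_ d A' B) (cong₂ _xor_ d∉A' d∉B)

    A'⊆D : A' ⊆ D
    A'⊆D = ⊆∁⁅x⁆ d A' d∉A'
    B⊆D : B ⊆ D
    B⊆D = ⊆∁⁅x⁆ d B d∉B
    C⊆D : C ⊆ D
    C⊆D = ⊆∁⁅x⁆ d C d∉C

    C△⁅d⁆≡A△B : C △ ⁅ d ⁆ ≡ A △ B
    C△⁅d⁆≡A△B = begin
      (A' △ B) △ ⁅ d ⁆    ≡⟨ △-assoc A' B ⁅ d ⁆ ⟩
      A' △ (B △ ⁅ d ⁆)    ≡⟨ cong (A' △_) (△-comm B ⁅ d ⁆) ⟩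
      A' △ (⁅ d ⁆ △ B)    ≡⟨ sym (△-assoc A' ⁅ d ⁆ B) ⟩
      (A' △ ⁅ d ⁆) △ B    ≡⟨ cong (_△ B) (△-cancelʳ A ⁅ d ⁆) ⟩
      A △ B               ∎
      where open ≡-Reasoning

    liftA'≡1 : lift A' ≡ 1ℚ
    liftA'≡1 = trans (cong f (trans (∪⁅x⁆≡△⁅x⁆ d A' d∉A') (△-cancelʳ A ⁅ d ⁆))) fA≡1

    liftC≡0 : lift C ≡ 0ℚ
    liftC≡0 = trans (cong f (trans (∪⁅x⁆≡△⁅x⁆ d C d∉C) C△⁅d⁆≡A△B)) fA△B≡0

    nonlinear-minor : HasNonlinearProperMinor f
    nonlinear-minor with zeroOne-at C | zeroOne-at A'
    ... | inj₁ fC≡0 | _ =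
      via-deletion (deletion-nonlinear A'⊆D B⊆D liftA'≡1 fB≡1 fC≡0 liftC≡0)
    ... | inj₂ fC≡1 | inj₁ fA'≡0 =
      via-contraction (contraction-nonlinear C⊆D B⊆D fC≡1 fB≡1 (trans (cong f (△-cancelʳ A' B)) fA'≡0))
    ... | inj₂ fC≡1 | inj₂ fA'≡1 =
      via-deletion (λ linear → deletion-not-zeroOne A'⊆D C⊆D fA'≡1 liftA'≡1 fC≡1 liftC≡0 (proj₁ linear))

closure-counterexample : ∀ {n} (f : SetFn n) → ZeroOneOn ⊤ f → ¬ Linear f →
  ∃[ A ] ∃[ B ] (f A ≡ 1ℚ × f B ≡ 1ℚ × f (A △ B) ≡ 0ℚ)
closure-counterexample f zeroOne nonlinear
  with anySubset? (λ A → anySubset? (λ B → f A ≟ 1ℚ ×-dec f B ≟ 1ℚ ×-dec ¬? (f (A △ B) ≟ 1ℚ)))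
... | yes (A , B , fA≡1 , fB≡1 , fA△B≢1) =
  A , B , fA≡1 , fB≡1 , ZeroOne∧≢1⇒≡0 (zeroOne (A △ B) ⊆⊤) fA△B≢1
... | no none = ⊥-elim (nonlinear (zeroOne , closed))
  where
  closed : ∀ A B → A ⊆ ⊤ → B ⊆ ⊤ → f A ≡ 1ℚ → f B ≡ 1ℚ → f (A △ B) ≡ 1ℚ
  closed A B _ _ fA≡1 fB≡1 =
    decidable-stable (f (A △ B) ≟ 1ℚ) (λ fA△B≢1 → none (A , B , fA≡1 , fB≡1 , fA△B≢1))

SeparatedCounterexample : ∀ {n} → SetFn n → Set
SeparatedCounterexample f = ∃[ A ] ∃[ B ] ∃[ d ] (lookup A d ≡ true × lookup B d ≡ false ×
  f A ≡ 1ℚ × f B ≡ 1ℚ × f (A △ B) ≡ 0ℚ)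

separated-counterexample : ∀ {n} (f : SetFn n) → IsBinaryFn f → ZeroOneOn ⊤ f → ¬ Linear f →
  SeparatedCounterexample f
separated-counterexample f binary zeroOne nonlinear
  with closure-counterexample f zeroOne nonlinear
... | A , B , fA≡1 , fB≡1 , fA△B≡0 with nonempty? (A △ B)
...   | no empty = ⊥-elim (0≢1 (trans (sym fA△B≡0) (trans (cong f (Empty-unique empty)) binary)))
...   | yes (d , d∈A△B) =
  orient (lookup A d) (lookup B d) refl refl (trans (sym (lookup-zipWith _xor_ d A B)) ([]=⇒lookup d∈A△B))
  where
  orient : ∀ a b → lookup A d ≡ a → lookup B d ≡ b → a xor b ≡ true → SeparatedCounterexample f
  orient true false d∈A d∉B _ = A , B , d , d∈A , d∉B , fA≡1 , fB≡1 , fA△B≡0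
  orient false true d∉A d∈B _ = B , A , d , d∈B , d∉A , fB≡1 , fA≡1 , trans (cong f (△-comm B A)) fA△B≡0

theorem8 : ∀ (n : ℕ) (f : SetFn n) → IsBinaryFn f → ZeroOneOn ⊤ f → ¬ Linear f →
    ∃[ X ] ∃[ Y ] (Disjoint X Y × ∣ ∁ (X ∪ Y) ∣ < n ×
      Σ (NonZero (delDen f Y)) (λ nz → ¬ LinearOn (∁ (X ∪ Y)) (minor f X Y {{nz}})))
theorem8 n f binary zeroOne nonlinear
  with separated-counterexample f binary zeroOne nonlinear
... | A , B , d , d∈A , d∉B , fA≡1 , fB≡1 , fA△B≡0 =
  PointMinors.Separated.nonlinear-minor f binary zeroOne d d∈A d∉B fA≡1 fB≡1 fA△B≡0
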